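{- Let $\mathbb S$ be Thompson's monoid and $u\in\mathbb S$. Then $\tau_0(u)=1$ if and only if $u=q^m$ for some irreducible $q\in\mathbb S$ and some $m\ge0$. In particular, if $u$ is not of this form then $\tau_0(u)\ge2$.
   Context: Thompson's group $\mathbb G$ is the group with presentation $\langle p_0,p_1,p_2,\ldots\mid p_jp_i=p_ip_{j+1}\ (0\le i<j)\rangle$, and Thompson's monoid $\mathbb S\subseteq\mathbb G$ is the submonoid generated by $p_0,p_1,p_2,\ldots$. For $z\in\mathbb S$, $\tau(z)=\#\{(z_1,z_2)\in\mathbb S\times\mathbb S:z=z_1z_2\}$; an element $q$ is irreducible if $\tau(q)=2$ (the irreducible elements of $\mathbb S$ are exactly $p_0,p_1,p_2,\ldots$). $\tau_0(u)=\lim_{n\to\infty}\tau(u^n)^{1/n}$, which exists because $\tau(uv)\le\tau(u)\tau(v)$ for all $u,v\in\mathbb S$. -}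

module Defs where

open import Data.Nat using (ℕ; zero; suc; _<_; _≥_)
open import Data.Integer using (+_)
open import Data.Rational using (ℚ; 0ℚ; 1ℚ; _*_; _-_; _+_; _/_) renaming (_≤_ to _≤ℚ_; _<_ to _<ℚ_)
open import Data.List using (List; []; _∷_; _++_; length)
open import Data.List.Relation.Unary.All using (All)
open import Data.List.Relation.Unary.Any using (Any)
open import Data.List.Relation.Unary.AllPairs using (AllPairs)
open import Data.Product using (Σ; ∃; _×_; _,_; proj₁; proj₂)
open import Relation.Nullary using (¬_)
open import Relation.Binary.PropositionalEquality using (_≡_)

-- Thompson's monoid S, presented by generators p₀,p₁,… and relations
-- p_j p_i = p_i p_{j+1} (i < j).  A word is a list of generator indices
-- (the list i₁ ∷ … ∷ iₖ ∷ [] stands for p_{i₁}⋯p_{iₖ}); elements of S are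
-- words up to the congruence _~_ generated by the relations.
Word : Set
Word = List ℕ

data _~_ : Word → Word → Set where
  ~-refl  : ∀ {w} → w ~ w
  ~-sym   : ∀ {v w} → v ~ w → w ~ v
  ~-trans : ∀ {u v w} → u ~ v → v ~ w → u ~ w
  ~-rel   : ∀ (xs ys : Word) {i j : ℕ} → i < j →
            (xs ++ j ∷ i ∷ ys) ~ (xs ++ i ∷ suc j ∷ ys)

gen : ℕ → Word
gen i = i ∷ []

_^ʷ_ : Word → ℕ → Word
u ^ʷ zero  = []
u ^ʷ suc n = u ++ (u ^ʷ n)

IsFactorization : Word → Word × Word → Set
IsFactorization z (a , b) = (a ++ b) ~ z

_≈₂_ : Word × Word → Word × Word → Set
(a , b) ≈₂ (a' , b') = (a ~ a') × (b ~ b')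

-- τ(z) = t : the set {(z₁,z₂) ∈ S × S : z = z₁ z₂} has exactly t elements,
-- witnessed by a list of t pairwise distinct factorizations that contains
-- (up to equality in S × S) every factorization.
HasTau : Word → ℕ → Set
HasTau z t =
  Σ (List (Word × Word)) λ fs →
    (length fs ≡ t) ×
    All (IsFactorization z) fs ×
    AllPairs (λ f g → ¬ (f ≈₂ g)) fs ×
    (∀ f → IsFactorization z f → Any (f ≈₂_) fs)

Irreducible : Word → Set
Irreducible q = HasTau q 2

_^ℚ_ : ℚ → ℕ → ℚ
x ^ℚ zero  = 1ℚ
x ^ℚ suc n = x * (x ^ℚ n)

ℕ→ℚ : ℕ → ℚ
ℕ→ℚ n = + n / 1

-- τ₀(u) = lim_{n→∞} τ(uⁿ)^{1/n} equals L (L > 0 rational), unfolded: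
-- for every 0 < ε < L there is N such that for all n ≥ N, τ(uⁿ) is defined
-- and L - ε ≤ τ(uⁿ)^{1/n} ≤ L + ε, i.e. (L-ε)ⁿ ≤ τ(uⁿ) ≤ (L+ε)ⁿ.
Tau0Is : Word → ℚ → Set
Tau0Is u L =
  ∀ (ε : ℚ) → 0ℚ <ℚ ε → ε <ℚ L →
    ∃ λ (N : ℕ) → ∀ (n : ℕ) → n ≥ N →
      ∃ λ (t : ℕ) → HasTau (u ^ʷ n) t ×
        ((L - ε) ^ℚ n ≤ℚ ℕ→ℚ t) × (ℕ→ℚ t ≤ℚ (L + ε) ^ℚ n)

-- τ₀(u) ≥ L (L > 0 rational), unfolded: for every 0 < ε < L there is N with
-- (L-ε)ⁿ ≤ τ(uⁿ) for all n ≥ N (i.e. liminf τ(uⁿ)^{1/n} ≥ L; the limit exists).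
Tau0AtLeast : Word → ℚ → Set
Tau0AtLeast u L =
  ∀ (ε : ℚ) → 0ℚ <ℚ ε → ε <ℚ L →
    ∃ λ (N : ℕ) → ∀ (n : ℕ) → n ≥ N →
      ∃ λ (t : ℕ) → HasTau (u ^ʷ n) t × ((L - ε) ^ℚ n ≤ℚ ℕ→ℚ t)

IsIrreduciblePower : Word → Set
IsIrreduciblePower u = ∃ λ (q : Word) → ∃ λ (m : ℕ) → Irreducible q × (u ~ (q ^ʷ m))

-- If u ~ p_i^m, no defining relation applies inside p_i^{nm}, so its factorizations are just its
-- nm + 1 splittings and τ(u^n) grows linearly, whence τ₀(u) = 1.  Otherwise the sorted normal
-- form of u is a v b with a < b.  With x = a v and k = |u|, u^n ~ x^n p_b p_{b+k} ⋯ p_{b+(n-1)k},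
-- and any subfamily of this progression can be moved to the right end.  The 2^n sorted right
-- factors so obtained are pairwise distinct, so τ(u^n) ≥ 2^n and τ₀(u) ≥ 2.  Irreducibles are
-- generators because a word of length ℓ has at least ℓ + 1 splittings.

module Submission where

open import Defs
open import Data.Rational using (1ℚ)
open import Data.Product using (_×_)
open import Relation.Nullary using (¬_)

module Growth where

  open import Data.Nat as ℕ using (ℕ; zero; suc; z≤n; s≤s)
  import Data.Nat.Properties as ℕ
  import Data.Nat.Tactic.RingSolver as ℕ-Solver
  open import Data.Integer as ℤ using (+[1+_]) renaming (+_ to pos)
  import Data.Integer.Tactic.RingSolver as ℤ-Solver
  open import Data.Rational using (0ℚ; 1ℚ; ½; _+_; _*_; _-_; -_; _≤_; _<_; mkℚ; *<*; toℚᵘ; nonNegative; positive)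
  open import Data.Rational.Properties
  open import Data.Rational.Solver using (module +-*-Solver)
  open +-*-Solver using (solve; con; _:+_; _:*_; _:=_)
  import Data.Rational.Unnormalised as ℚᵘ
  import Data.Rational.Unnormalised.Properties as ℚᵘ
  open import Data.Product using (∃; _×_; _,_; proj₁; proj₂)
  open import Relation.Binary.PropositionalEquality using (_≡_; refl; sym; trans; cong; cong₂; subst; subst₂; module ≡-Reasoning)
  open import Relation.Nullary using (¬_)
  open import Relation.Nullary.Decidable using (from-yes)

  -- ℕ→ℚ n is definitionally fromℚᵘ (n / 1), so the identity can be checked on unnormalised fractions.
  ℕ→ℚ-suc : ∀ n → ℕ→ℚ (suc n) ≡ 1ℚ + ℕ→ℚ n
  ℕ→ℚ-suc n = toℚᵘ-injective (begin-equality
    toℚᵘ (ℕ→ℚ (suc n))         ≃⟨ toℚᵘ-fromℚᵘ (ι (suc n)) ⟩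
    ι (suc n)                  ≃⟨ ℚᵘ.*≡* (identity (pos n)) ⟩
    ι 1 ℚᵘ.+ ι n               ≃⟨ ℚᵘ.+-cong (toℚᵘ-fromℚᵘ (ι 1)) (toℚᵘ-fromℚᵘ (ι n)) ⟨
    toℚᵘ 1ℚ ℚᵘ.+ toℚᵘ (ℕ→ℚ n)  ≃⟨ toℚᵘ-homo-+ 1ℚ (ℕ→ℚ n) ⟨
    toℚᵘ (1ℚ + ℕ→ℚ n)          ∎)
    where
    open ℚᵘ.≤-Reasoning
    ι : ℕ → ℚᵘ.ℚᵘ
    ι n = ℚᵘ.mkℚᵘ (pos n) 0
    identity : ∀ x → (pos 1 ℤ.+ x) ℤ.* pos 1 ≡ (pos 1 ℤ.* pos 1 ℤ.+ x ℤ.* pos 1) ℤ.* pos 1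
    identity = ℤ-Solver.solve-∀

  ℕ→ℚ-+ : ∀ m n → ℕ→ℚ (m ℕ.+ n) ≡ ℕ→ℚ m + ℕ→ℚ n
  ℕ→ℚ-+ zero    n = sym (+-identityˡ (ℕ→ℚ n))
  ℕ→ℚ-+ (suc m) n = begin
    ℕ→ℚ (suc m ℕ.+ n)          ≡⟨ ℕ→ℚ-suc (m ℕ.+ n) ⟩
    1ℚ + ℕ→ℚ (m ℕ.+ n)         ≡⟨ cong (1ℚ +_) (ℕ→ℚ-+ m n) ⟩
    1ℚ + (ℕ→ℚ m + ℕ→ℚ n)       ≡⟨ +-assoc 1ℚ (ℕ→ℚ m) (ℕ→ℚ n) ⟨
    1ℚ + ℕ→ℚ m + ℕ→ℚ n         ≡⟨ cong (_+ ℕ→ℚ n) (ℕ→ℚ-suc m) ⟨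
    ℕ→ℚ (suc m) + ℕ→ℚ n        ∎
    where open ≡-Reasoning

  ℕ→ℚ-* : ∀ m n → ℕ→ℚ (m ℕ.* n) ≡ ℕ→ℚ m * ℕ→ℚ n
  ℕ→ℚ-* zero    n = sym (*-zeroˡ (ℕ→ℚ n))
  ℕ→ℚ-* (suc m) n = begin
    ℕ→ℚ (n ℕ.+ m ℕ.* n)         ≡⟨ ℕ→ℚ-+ n (m ℕ.* n) ⟩
    ℕ→ℚ n + ℕ→ℚ (m ℕ.* n)       ≡⟨ cong₂ _+_ (*-identityˡ (ℕ→ℚ n)) (sym (ℕ→ℚ-* m n)) ⟨
    1ℚ * ℕ→ℚ n + ℕ→ℚ m * ℕ→ℚ n  ≡⟨ *-distribʳ-+ (ℕ→ℚ n) 1ℚ (ℕ→ℚ m) ⟨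
    (1ℚ + ℕ→ℚ m) * ℕ→ℚ n        ≡⟨ cong (_* ℕ→ℚ n) (ℕ→ℚ-suc m) ⟨
    ℕ→ℚ (suc m) * ℕ→ℚ n         ∎
    where open ≡-Reasoning

  ℕ→ℚ-^ : ∀ m n → ℕ→ℚ (m ℕ.^ n) ≡ ℕ→ℚ m ^ℚ n
  ℕ→ℚ-^ m zero    = refl
  ℕ→ℚ-^ m (suc n) = trans (ℕ→ℚ-* m (m ℕ.^ n)) (cong (ℕ→ℚ m *_) (ℕ→ℚ-^ m n))

  0≤ℕ→ℚ : ∀ n → 0ℚ ≤ ℕ→ℚ n
  0≤ℕ→ℚ n = nonNegative⁻¹ (ℕ→ℚ n) {{normalize-nonNeg n 1}}

  p≤p+q : ∀ p {q} → 0ℚ ≤ q → p ≤ p + q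
  p≤p+q p {q} 0≤q = subst (_≤ p + q) (+-identityʳ p) (+-monoʳ-≤ p 0≤q)

  ℕ→ℚ-mono-≤ : ∀ {m n} → m ℕ.≤ n → ℕ→ℚ m ≤ ℕ→ℚ n
  ℕ→ℚ-mono-≤ {m} m≤n with ℕ.m≤n⇒∃[o]m+o≡n m≤n
  ... | o , refl = subst (ℕ→ℚ m ≤_) (sym (ℕ→ℚ-+ m o)) (p≤p+q (ℕ→ℚ m) (0≤ℕ→ℚ o))

  *-nonneg : ∀ {p q} → 0ℚ ≤ p → 0ℚ ≤ q → 0ℚ ≤ p * q
  *-nonneg {p} {q} 0≤p 0≤q =
    nonNegative⁻¹ (p * q) {{nonNeg*nonNeg⇒nonNeg p {{nonNegative 0≤p}} q {{nonNegative 0≤q}}}}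

  0≤1 : 0ℚ ≤ 1ℚ
  0≤1 = from-yes (0ℚ ≤? 1ℚ)

  1^ℚ : ∀ n → 1ℚ ^ℚ n ≡ 1ℚ
  1^ℚ zero    = refl
  1^ℚ (suc n) = trans (*-identityˡ (1ℚ ^ℚ n)) (1^ℚ n)

  ^ℚ-nonneg : ∀ n {p} → 0ℚ ≤ p → 0ℚ ≤ p ^ℚ n
  ^ℚ-nonneg zero    _   = 0≤1
  ^ℚ-nonneg (suc n) 0≤p = *-nonneg 0≤p (^ℚ-nonneg n 0≤p)

  ^ℚ-pos : ∀ n {p} → 0ℚ < p → 0ℚ < p ^ℚ n
  ^ℚ-pos zero    _   = from-yes (0ℚ <? 1ℚ)
  ^ℚ-pos (suc n) {p} 0<p = subst (_< p * p ^ℚ n) (*-zeroˡ (p ^ℚ n))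
    (*-monoˡ-<-pos (p ^ℚ n) {{positive (^ℚ-pos n 0<p)}} 0<p)

  ^ℚ-mono-≤ : ∀ n {p q} → 0ℚ ≤ p → p ≤ q → p ^ℚ n ≤ q ^ℚ n
  ^ℚ-mono-≤ zero    _   _   = ≤-refl
  ^ℚ-mono-≤ (suc n) {p} {q} 0≤p p≤q = begin
    p * p ^ℚ n  ≤⟨ *-monoʳ-≤-nonNeg (p ^ℚ n) {{nonNegative (^ℚ-nonneg n 0≤p)}} p≤q ⟩
    q * p ^ℚ n  ≤⟨ *-monoˡ-≤-nonNeg q {{nonNegative (≤-trans 0≤p p≤q)}} (^ℚ-mono-≤ n 0≤p p≤q) ⟩
    q * q ^ℚ n  ∎
    where open ≤-Reasoning

  ^ℚ-mono-< : ∀ n {p q} → 0ℚ ≤ p → p < q → p ^ℚ suc n < q ^ℚ suc n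
  ^ℚ-mono-< n {p} {q} 0≤p p<q = begin-strict
    p * p ^ℚ n  ≤⟨ *-monoˡ-≤-nonNeg p {{nonNegative 0≤p}} (^ℚ-mono-≤ n 0≤p (<⇒≤ p<q)) ⟩
    p * q ^ℚ n  <⟨ *-monoˡ-<-pos (q ^ℚ n) {{positive (^ℚ-pos n (≤-<-trans 0≤p p<q))}} p<q ⟩
    q * q ^ℚ n  ∎
    where open ≤-Reasoning

  [p-ε]^ℚ≤p^ℚ : ∀ n {p ε} → 0ℚ ≤ ε → ε ≤ p → (p - ε) ^ℚ n ≤ p ^ℚ n
  [p-ε]^ℚ≤p^ℚ n {p} {ε} 0≤ε ε≤p = ^ℚ-mono-≤ n 0≤p-ε p-ε≤p
    where
    0≤p-ε : 0ℚ ≤ p - ε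
    0≤p-ε = subst (_≤ p - ε) (+-inverseʳ ε) (+-monoˡ-≤ (- ε) ε≤p)
    p-ε≤p : p - ε ≤ p
    p-ε≤p = subst (p - ε ≤_) (+-identityʳ p) (+-monoʳ-≤ p (neg-antimono-≤ 0≤ε))

  bernoulli-step : ∀ {d a b p} → 0ℚ ≤ d → a ≤ p → b ≤ p → a + d * b ≤ (1ℚ + d) * p
  bernoulli-step {d} {a} {b} {p} 0≤d a≤p b≤p = begin
    a + d * b       ≤⟨ +-mono-≤ a≤p (*-monoˡ-≤-nonNeg d {{nonNegative 0≤d}} b≤p) ⟩
    p + d * p       ≡⟨ cong (_+ d * p) (*-identityˡ p) ⟨
    1ℚ * p + d * p  ≡⟨ *-distribʳ-+ p 1ℚ d ⟨
    (1ℚ + d) * p    ∎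
    where open ≤-Reasoning

  1≤[1+d]^ℚ : ∀ n {d} → 0ℚ ≤ d → 1ℚ ≤ (1ℚ + d) ^ℚ n
  1≤[1+d]^ℚ n {d} 0≤d = subst (_≤ (1ℚ + d) ^ℚ n) (1^ℚ n) (^ℚ-mono-≤ n 0≤1 (p≤p+q 1ℚ 0≤d))

  bernoulli : ∀ n {d} → 0ℚ ≤ d → ℕ→ℚ n * d ≤ (1ℚ + d) ^ℚ n
  bernoulli zero    {d} _   = subst (_≤ 1ℚ) (sym (*-zeroˡ d)) 0≤1
  bernoulli (suc n) {d} 0≤d =
    subst (_≤ (1ℚ + d) ^ℚ suc n) (sym expand) (bernoulli-step 0≤d (bernoulli n 0≤d) (1≤[1+d]^ℚ n 0≤d))
    where
    expand : ℕ→ℚ (suc n) * d ≡ ℕ→ℚ n * d + d * 1ℚ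
    expand = trans (cong (_* d) (ℕ→ℚ-suc n))
      (solve 2 (λ N d → (con 1ℚ :+ N) :* d := N :* d :+ d :* con 1ℚ) refl (ℕ→ℚ n) d)

  triangle : ℕ → ℕ
  triangle zero    = 0
  triangle (suc n) = triangle n ℕ.+ n

  bernoulli₂ : ∀ n {d} → 0ℚ ≤ d → ℕ→ℚ (triangle n) * (d * d) ≤ (1ℚ + d) ^ℚ n
  bernoulli₂ zero    {d} _   = subst (_≤ 1ℚ) (sym (*-zeroˡ (d * d))) 0≤1
  bernoulli₂ (suc n) {d} 0≤d =
    subst (_≤ (1ℚ + d) ^ℚ suc n) (sym expand) (bernoulli-step 0≤d (bernoulli₂ n 0≤d) (bernoulli n 0≤d))
    where
    expand : ℕ→ℚ (triangle n ℕ.+ n) * (d * d) ≡ ℕ→ℚ (triangle n) * (d * d) + d * (ℕ→ℚ n * d)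
    expand = trans (cong (_* (d * d)) (ℕ→ℚ-+ (triangle n) n))
      (solve 3 (λ T N d → (T :+ N) :* (d :* d) := T :* (d :* d) :+ d :* (N :* d)) refl (ℕ→ℚ (triangle n)) (ℕ→ℚ n) d)

  -- For ε = (p+1)/(d+1) take K = d+1; the first step is (d+1) ≤ (d+1)(p+1) on unnormalised fractions.
  archimedean : ∀ ε → 0ℚ < ε → ∃ λ K → 1ℚ ≤ ℕ→ℚ K * ε
  archimedean ε@(mkℚ +[1+ p ] d _) _ = suc d , toℚᵘ-cancel-≤ (begin
    ℚᵘ.1ℚᵘ                            ≤⟨ ℚᵘ.*≤* (ℤ.+≤+ (s≤s d≤)) ⟩
    ℚᵘ.mkℚᵘ (pos (suc d)) 0 ℚᵘ.* toℚᵘ ε ≃⟨ ℚᵘ.*-congʳ (toℚᵘ-fromℚᵘ (ℚᵘ.mkℚᵘ (pos (suc d)) 0)) ⟨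
    toℚᵘ (ℕ→ℚ (suc d)) ℚᵘ.* toℚᵘ ε   ≃⟨ toℚᵘ-homo-* (ℕ→ℚ (suc d)) ε ⟨
    toℚᵘ (ℕ→ℚ (suc d) * ε)          ∎)
    where
    open ℚᵘ.≤-Reasoning
    d≤ : d ℕ.+ 0 ℕ.* suc d ℕ.+ 0 ℕ.* suc (d ℕ.+ 0 ℕ.* suc d) ℕ.≤ (p ℕ.+ d ℕ.* suc p) ℕ.* 1
    d≤ = ℕ.≤-trans (ℕ.≤-reflexive (collapse d)) (ℕ.≤-trans (ℕ.≤-trans (ℕ.m≤m*n d (suc p)) (ℕ.m≤n+m _ p))
          (ℕ.≤-reflexive (sym (ℕ.*-identityʳ _))))
      where
      collapse : ∀ d → d ℕ.+ 0 ℕ.* suc d ℕ.+ 0 ℕ.* suc (d ℕ.+ 0 ℕ.* suc d) ≡ d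
      collapse = ℕ-Solver.solve-∀
  archimedean (mkℚ (pos 0)    _ _) (*<* (ℤ.+<+ ()))
  archimedean (mkℚ ℤ.-[1+ _ ] _ _) (*<* ())

  *≤triangle : ∀ a b → a ℕ.* b ℕ.≤ triangle (a ℕ.+ b)
  *≤triangle a zero    = subst (ℕ._≤ triangle (a ℕ.+ 0)) (sym (ℕ.*-zeroʳ a)) z≤n
  *≤triangle a (suc b) =
    subst₂ ℕ._≤_ (trans (ℕ.+-comm (a ℕ.* b) a) (sym (ℕ.*-suc a b))) (cong triangle (sym (ℕ.+-suc a b)))
      (ℕ.+-mono-≤ (*≤triangle a b) (ℕ.m≤m+n a b))

  eventually-linear≤triangle : ∀ c m → ∃ λ N → ∀ n → N ℕ.≤ n → c ℕ.* suc (n ℕ.* m) ℕ.≤ triangle n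
  eventually-linear≤triangle c m = B ℕ.+ suc (m ℕ.* B) , bound
    where
    B : ℕ
    B = c ℕ.* suc m
    bound : ∀ n → B ℕ.+ suc (m ℕ.* B) ℕ.≤ n → c ℕ.* suc (n ℕ.* m) ℕ.≤ triangle n
    bound n N≤n with ℕ.m≤n⇒∃[o]m+o≡n N≤n
    ... | j , refl = ℕ.≤-trans (ℕ.m≤m+n _ (c ℕ.* j)) (ℕ.≤-trans (ℕ.≤-reflexive (identity c m j))
                       (subst (B ℕ.* (suc (m ℕ.* B) ℕ.+ j) ℕ.≤_) (cong triangle (sym (ℕ.+-assoc B _ j)))
                              (*≤triangle B (suc (m ℕ.* B) ℕ.+ j))))
      where
      -- with n = B + (1 + m B) + j, the excess of B (1 + m B + j) over c (1 + n m) is exactly c j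
      identity : ∀ c m j → c ℕ.* suc ((c ℕ.* suc m ℕ.+ suc (m ℕ.* (c ℕ.* suc m)) ℕ.+ j) ℕ.* m) ℕ.+ c ℕ.* j
                         ≡ c ℕ.* suc m ℕ.* (suc (m ℕ.* (c ℕ.* suc m)) ℕ.+ j)
      identity = ℕ-Solver.solve-∀

  1≤p⇒1≤p*p : ∀ {p} → 1ℚ ≤ p → 1ℚ ≤ p * p
  1≤p⇒1≤p*p {p} 1≤p = begin
    1ℚ      ≤⟨ 1≤p ⟩
    p       ≡⟨ *-identityʳ p ⟨
    p * 1ℚ  ≤⟨ *-monoˡ-≤-nonNeg p {{nonNegative (≤-trans 0≤1 1≤p)}} 1≤p ⟩
    p * p   ∎
    where open ≤-Reasoning

  linear≤exponential : ∀ m ε → 0ℚ < ε → ∃ λ N → ∀ n → N ℕ.≤ n → ℕ→ℚ (suc (n ℕ.* m)) ≤ (1ℚ + ε) ^ℚ n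
  linear≤exponential m ε 0<ε with archimedean ε 0<ε
  ... | K , 1≤Kε with eventually-linear≤triangle (K ℕ.* K) m
  ... | N , bound = N , λ n N≤n → let s = ℕ→ℚ (suc (n ℕ.* m)) in begin
    s                                          ≡⟨ *-identityʳ s ⟨
    s * 1ℚ                                     ≤⟨ *-monoˡ-≤-nonNeg s {{nonNegative (0≤ℕ→ℚ (suc (n ℕ.* m)))}} 1≤[Kε]² ⟩
    s * ((ℕ→ℚ K * ε) * (ℕ→ℚ K * ε))            ≡⟨ rearrange s (ℕ→ℚ K) ε ⟩
    ℕ→ℚ K * ℕ→ℚ K * s * (ε * ε)                ≡⟨ cong (_* (ε * ε)) (ℕ→ℚ-*² K _) ⟨
    ℕ→ℚ (K ℕ.* K ℕ.* suc (n ℕ.* m)) * (ε * ε)  ≤⟨ *-monoʳ-≤-nonNeg (ε * ε) {{nonNegative 0≤ε²}} (ℕ→ℚ-mono-≤ (bound n N≤n)) ⟩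
    ℕ→ℚ (triangle n) * (ε * ε)                 ≤⟨ bernoulli₂ n (<⇒≤ 0<ε) ⟩
    (1ℚ + ε) ^ℚ n                              ∎
    where
    open ≤-Reasoning
    1≤[Kε]² : 1ℚ ≤ (ℕ→ℚ K * ε) * (ℕ→ℚ K * ε)
    1≤[Kε]² = 1≤p⇒1≤p*p 1≤Kε
    0≤ε² : 0ℚ ≤ ε * ε
    0≤ε² = *-nonneg (<⇒≤ 0<ε) (<⇒≤ 0<ε)
    ℕ→ℚ-*² : ∀ k s → ℕ→ℚ (k ℕ.* k ℕ.* s) ≡ ℕ→ℚ k * ℕ→ℚ k * ℕ→ℚ s
    ℕ→ℚ-*² k s = trans (ℕ→ℚ-* (k ℕ.* k) s) (cong (_* ℕ→ℚ s) (ℕ→ℚ-* k k))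
    rearrange : ∀ s k ε → s * ((k * ε) * (k * ε)) ≡ k * k * s * (ε * ε)
    rearrange = solve 3 (λ s k ε → s :* ((k :* ε) :* (k :* ε)) := k :* k :* s :* (ε :* ε)) refl

  ExponentialTau : Word → Set
  ExponentialTau u = ∀ n t → HasTau (u ^ʷ n) t → 2 ℕ.^ n ℕ.≤ t

  linear⇒τ₀≡1 : ∀ {u} m → (∀ n → HasTau (u ^ʷ n) (suc (n ℕ.* m))) → Tau0Is u 1ℚ
  linear⇒τ₀≡1 {u} m τuⁿ ε 0<ε ε<1 = N , bounds
    where
    N : ℕ
    N = proj₁ (linear≤exponential m ε 0<ε)
    lower : ∀ n → (1ℚ - ε) ^ℚ n ≤ ℕ→ℚ (suc (n ℕ.* m))
    lower n = begin
      (1ℚ - ε) ^ℚ n          ≤⟨ [p-ε]^ℚ≤p^ℚ n (<⇒≤ 0<ε) (<⇒≤ ε<1) ⟩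
      1ℚ ^ℚ n                ≡⟨ 1^ℚ n ⟩
      ℕ→ℚ 1                  ≤⟨ ℕ→ℚ-mono-≤ {1} {suc (n ℕ.* m)} (s≤s z≤n) ⟩
      ℕ→ℚ (suc (n ℕ.* m))    ∎
      where open ≤-Reasoning
    bounds : ∀ n → n ℕ.≥ N → ∃ λ t → HasTau (u ^ʷ n) t × ((1ℚ - ε) ^ℚ n ≤ ℕ→ℚ t) × (ℕ→ℚ t ≤ (1ℚ + ε) ^ℚ n)
    bounds n N≤n = suc (n ℕ.* m) , τuⁿ n , lower n , proj₂ (linear≤exponential m ε 0<ε) n N≤n

  0<½ : 0ℚ < ½
  0<½ = from-yes (0ℚ <? ½)

  ½<1 : ½ < 1ℚ
  ½<1 = from-yes (½ <? 1ℚ)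

  0≤1+½ : 0ℚ ≤ 1ℚ + ½
  0≤1+½ = from-yes (0ℚ ≤? 1ℚ + ½)

  1+½<2 : 1ℚ + ½ < ℕ→ℚ 2
  1+½<2 = from-yes (1ℚ + ½ <? ℕ→ℚ 2)

  exponential⇒τ₀≢1 : ∀ {u} → ExponentialTau u → ¬ Tau0Is u 1ℚ
  exponential⇒τ₀≢1 {u} exponential τ₀≡1 = too-many (proj₂ (τ₀≡1 ½ 0<½ ½<1) (suc N) (ℕ.n≤1+n N))
    where
    N : ℕ
    N = proj₁ (τ₀≡1 ½ 0<½ ½<1)
    too-many : ¬ ∃ λ t → HasTau (u ^ʷ suc N) t × ((1ℚ - ½) ^ℚ suc N ≤ ℕ→ℚ t) × (ℕ→ℚ t ≤ (1ℚ + ½) ^ℚ suc N)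
    too-many (t , τuⁿ , _ , t≤) = <-irrefl refl (begin-strict
      ℕ→ℚ (2 ℕ.^ suc N)     ≤⟨ ℕ→ℚ-mono-≤ (exponential (suc N) t τuⁿ) ⟩
      ℕ→ℚ t                 ≤⟨ t≤ ⟩
      (1ℚ + ½) ^ℚ suc N     <⟨ ^ℚ-mono-< N 0≤1+½ 1+½<2 ⟩
      ℕ→ℚ 2 ^ℚ suc N        ≡⟨ ℕ→ℚ-^ 2 (suc N) ⟨
      ℕ→ℚ (2 ℕ.^ suc N)     ∎)
      where open ≤-Reasoning

  exponential⇒τ₀≥2 : ∀ {u} → (∀ n → ∃ (HasTau (u ^ʷ n))) → ExponentialTau u → Tau0AtLeast u (ℕ→ℚ 2)
  exponential⇒τ₀≥2 {u} τ-exists exponential ε 0<ε ε<2 = 0 , λ n _ → lower n (τ-exists n)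
    where
    lower : ∀ n → ∃ (HasTau (u ^ʷ n)) → ∃ λ t → HasTau (u ^ʷ n) t × ((ℕ→ℚ 2 - ε) ^ℚ n ≤ ℕ→ℚ t)
    lower n (t , τuⁿ) = t , τuⁿ , (begin
      (ℕ→ℚ 2 - ε) ^ℚ n   ≤⟨ [p-ε]^ℚ≤p^ℚ n (<⇒≤ 0<ε) (<⇒≤ ε<2) ⟩
      ℕ→ℚ 2 ^ℚ n         ≡⟨ ℕ→ℚ-^ 2 n ⟨
      ℕ→ℚ (2 ℕ.^ n)      ≤⟨ ℕ→ℚ-mono-≤ (exponential n t τuⁿ) ⟩
      ℕ→ℚ t              ∎)
      where open ≤-Reasoning


open Growth using (ExponentialTau; linear⇒τ₀≡1; exponential⇒τ₀≢1; exponential⇒τ₀≥2)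

open import Data.Empty using (⊥-elim)
open import Data.Fin.Patterns using (0F; 1F)
open import Data.Fin as Fin using (Fin; toℕ; fromℕ<; quotient; remainder; remQuot; combine)
open import Data.Fin.Properties using (combine-remQuot; toℕ≤pred[n]; toℕ-injective; toℕ-fromℕ<; injective⇒≤)
open import Data.List using (List; map; concatMap; upTo; cartesianProduct; filter; deduplicate; []; _∷_; _++_; _∷ʳ_; length; foldr; replicate; take; drop; tabulate)
open import Data.List.Properties using (∷-injectiveʳ; length-replicate; ++-assoc; length-++; foldr-++; length-take; length-tabulate; take++drop≡id; ≡-dec)
open import Data.List.Relation.Unary.All as All using (All; []; _∷_)
import Data.List.Relation.Unary.All.Properties as All
open import Data.List.Relation.Unary.Any as Any using (Any; here; there)
open import Data.List.Relation.Binary.Subset.Propositional using (_⊆_)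
open import Data.List.Membership.Propositional using (_∈_)
open import Data.List.Membership.Propositional.Properties using (∈-concatMap⁺; ∈-map⁺; ∈-upTo⁺; ∈-filter⁺; ∈-cartesianProduct⁺)
open import Data.List.Relation.Unary.Unique.DecSetoid.Properties using (deduplicate-!)
open import Data.List.Extrema.Nat using (max; v≤max⁺)
open import Data.List.Relation.Binary.Subset.Propositional.Properties using (Any-resp-⊆)
import Data.List.Relation.Unary.Any.Properties as Any
open import Data.List.Relation.Unary.AllPairs using ([]; _∷_)
import Data.List.Relation.Unary.AllPairs.Properties as AllPairs
open import Data.Nat using (ℕ; zero; suc; z<s; pred; _+_; _*_; _^_; _≤_; _<_; _<?_; _≟_; z≤n; s≤s)
open import Data.Nat.Properties using (m≤n+m; ≤∧≢⇒<; m+1+n≰m; pred-mono-≤; <-≤-trans; m<m+n; ≤-reflexive; +-assoc; ≤-<-trans; +-identityʳ; m≤m+n; ≤-<-connex; ≤-totalOrder; ≤-refl; ≤-trans; <-trans; <⇒≤; ≮⇒≥; <-irrefl; n≤1+n; m<n⇒m<1+n; m≤n⇒m⊓n≡m; +-suc)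
open import Data.List.Relation.Unary.Sorted.TotalOrder ≤-totalOrder using (Sorted)
open import Data.List.Relation.Unary.Linked using ([]; [-]; _∷_)
open import Data.Sum using (_⊎_; inj₁; inj₂)
open import Data.Product using (∃; _,_; proj₁; proj₂; uncurry)
open import Data.Unit using (⊤; tt)
open import Data.Vec as Vec using (Vec; []; _∷_)
open import Relation.Binary using (IsEquivalence; Setoid; DecSetoid; Decidable)
import Relation.Unary as U
open import Relation.Binary.PropositionalEquality using (_≡_; refl; sym; trans; cong; cong₂; subst; subst₂; module ≡-Reasoning)
open import Data.Nat.Tactic.RingSolver using (solve-∀)
import Relation.Binary.Reasoning.Setoid as SetoidReasoning
open import Relation.Nullary using (yes; no)
open import Relation.Nullary.Decidable using (map′; _×-dec_)
open import Function using (_∘_; const)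

≡⇒~ : ∀ {v w} → v ≡ w → v ~ w
≡⇒~ refl = ~-refl

~-++ˡ : ∀ xs {v w} → v ~ w → (xs ++ v) ~ (xs ++ w)
~-++ˡ xs ~-refl          = ~-refl
~-++ˡ xs (~-sym p)       = ~-sym (~-++ˡ xs p)
~-++ˡ xs (~-trans p q)   = ~-trans (~-++ˡ xs p) (~-++ˡ xs q)
~-++ˡ xs (~-rel ys zs {i} {j} i<j) =
  subst₂ _~_ (++-assoc xs ys (j ∷ i ∷ zs)) (++-assoc xs ys (i ∷ suc j ∷ zs)) (~-rel (xs ++ ys) zs i<j)

~-++ʳ : ∀ zs {v w} → v ~ w → (v ++ zs) ~ (w ++ zs)
~-++ʳ zs ~-refl          = ~-refl
~-++ʳ zs (~-sym p)       = ~-sym (~-++ʳ zs p)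
~-++ʳ zs (~-trans p q)   = ~-trans (~-++ʳ zs p) (~-++ʳ zs q)
~-++ʳ zs (~-rel xs ys {i} {j} i<j) =
  subst₂ _~_ (sym (++-assoc xs (j ∷ i ∷ ys) zs)) (sym (++-assoc xs (i ∷ suc j ∷ ys) zs)) (~-rel xs (ys ++ zs) i<j)

~-++ : ∀ {a b c d} → a ~ b → c ~ d → (a ++ c) ~ (b ++ d)
~-++ {b = b} {c = c} a~b c~d = ~-trans (~-++ʳ c a~b) (~-++ˡ b c~d)

~-length : ∀ {v w} → v ~ w → length v ≡ length w
~-length ~-refl                  = refl
~-length (~-sym p)               = sym (~-length p)
~-length (~-trans p q)           = trans (~-length p) (~-length q)
~-length (~-rel xs ys _)         = trans (length-++ xs) (sym (length-++ xs))

~-isEquivalence : IsEquivalence _~_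
~-isEquivalence = record { refl = ~-refl ; sym = ~-sym ; trans = ~-trans }

~-setoid : Setoid _ _
~-setoid = record { isEquivalence = ~-isEquivalence }

^ʷ-cong : ∀ {u w} n → u ~ w → (u ^ʷ n) ~ (w ^ʷ n)
^ʷ-cong zero    _   = ~-refl
^ʷ-cong (suc n) u~w = ~-++ u~w (^ʷ-cong n u~w)

-- Normal forms

-- Nondecreasing words are normal forms: nf w is the unique sorted word with nf w ~ w.
insert : ℕ → Word → Word
insert x []      = x ∷ []
insert x (y ∷ w) with y <? x
... | yes _ = y ∷ insert (suc x) w
... | no  _ = x ∷ y ∷ w

nf : Word → Word
nf = foldr insert []

insert-< : ∀ {x y w} → y < x → insert x (y ∷ w) ≡ y ∷ insert (suc x) w
insert-< {x} {y} y<x with y <? x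
... | yes _   = refl
... | no  y≮x = ⊥-elim (y≮x y<x)

insert-≥ : ∀ {x y w} → x ≤ y → insert x (y ∷ w) ≡ x ∷ y ∷ w
insert-≥ {x} {y} x≤y with y <? x
... | yes y<x = ⊥-elim (<-irrefl refl (≤-trans y<x x≤y))
... | no  _   = refl

insert-comm : ∀ {i j} → i < j → ∀ w → insert j (insert i w) ≡ insert i (insert (suc j) w)
insert-comm {i} {j} i<j [] = trans (insert-< i<j) (sym (insert-≥ (≤-trans (<⇒≤ i<j) (n≤1+n j))))
insert-comm {i} {j} i<j (y ∷ w) with ≤-<-connex i y | ≤-<-connex (suc j) y
... | inj₂ y<i | _ = begin
  insert j (insert i (y ∷ w))                    ≡⟨ cong (insert j) (insert-< y<i) ⟩
  insert j (y ∷ insert (suc i) w)                ≡⟨ insert-< (<-trans y<i i<j) ⟩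
  y ∷ insert (suc j) (insert (suc i) w)          ≡⟨ cong (y ∷_) (insert-comm (s≤s i<j) w) ⟩
  y ∷ insert (suc i) (insert (suc (suc j)) w)    ≡⟨ insert-< y<i ⟨
  insert i (y ∷ insert (suc (suc j)) w)          ≡⟨ cong (insert i) (insert-< (m<n⇒m<1+n (<-trans y<i i<j))) ⟨
  insert i (insert (suc j) (y ∷ w))              ∎
  where open ≡-Reasoning
... | inj₁ i≤y | inj₂ y<1+j = begin
  insert j (insert i (y ∷ w))                    ≡⟨ cong (insert j) (insert-≥ i≤y) ⟩
  insert j (i ∷ y ∷ w)                           ≡⟨ insert-< i<j ⟩
  i ∷ insert (suc j) (y ∷ w)                     ≡⟨ cong (i ∷_) (insert-< y<1+j) ⟩
  i ∷ y ∷ insert (suc (suc j)) w                 ≡⟨ insert-≥ i≤y ⟨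
  insert i (y ∷ insert (suc (suc j)) w)          ≡⟨ cong (insert i) (insert-< y<1+j) ⟨
  insert i (insert (suc j) (y ∷ w))              ∎
  where open ≡-Reasoning
... | inj₁ i≤y | inj₁ 1+j≤y = begin
  insert j (insert i (y ∷ w))                    ≡⟨ cong (insert j) (insert-≥ i≤y) ⟩
  insert j (i ∷ y ∷ w)                           ≡⟨ insert-< i<j ⟩
  i ∷ insert (suc j) (y ∷ w)                     ≡⟨ cong (i ∷_) (insert-≥ 1+j≤y) ⟩
  i ∷ suc j ∷ y ∷ w                              ≡⟨ insert-≥ (≤-trans (<⇒≤ i<j) (n≤1+n j)) ⟨
  insert i (suc j ∷ y ∷ w)                       ≡⟨ cong (insert i) (insert-≥ 1+j≤y) ⟨
  insert i (insert (suc j) (y ∷ w))              ∎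
  where open ≡-Reasoning

~⇒nf≡ : ∀ {v w} → v ~ w → nf v ≡ nf w
~⇒nf≡ ~-refl        = refl
~⇒nf≡ (~-sym p)     = sym (~⇒nf≡ p)
~⇒nf≡ (~-trans p q) = trans (~⇒nf≡ p) (~⇒nf≡ q)
~⇒nf≡ (~-rel xs ys {i} {j} i<j) = begin
  nf (xs ++ j ∷ i ∷ ys)                               ≡⟨ foldr-++ insert [] xs _ ⟩
  foldr insert (insert j (insert i (nf ys))) xs       ≡⟨ cong (λ w → foldr insert w xs) (insert-comm i<j (nf ys)) ⟩
  foldr insert (insert i (insert (suc j) (nf ys))) xs ≡⟨ foldr-++ insert [] xs _ ⟨
  nf (xs ++ i ∷ suc j ∷ ys)                           ∎
  where open ≡-Reasoning

insert-~ : ∀ x w → insert x w ~ (x ∷ w)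
insert-~ x []      = ~-refl
insert-~ x (y ∷ w) with y <? x
... | yes y<x = ~-trans (~-++ˡ (y ∷ []) (insert-~ (suc x) w)) (~-sym (~-rel [] w y<x))
... | no  _   = ~-refl

nf-~ : ∀ w → nf w ~ w
nf-~ []      = ~-refl
nf-~ (x ∷ w) = ~-trans (insert-~ x (nf w)) (~-++ˡ (x ∷ []) (nf-~ w))

nf≡⇒~ : ∀ {v w} → nf v ≡ nf w → v ~ w
nf≡⇒~ {v} {w} eq = ~-trans (~-sym (nf-~ v)) (~-trans (≡⇒~ eq) (nf-~ w))

_~?_ : Decidable _~_
v ~? w = map′ nf≡⇒~ ~⇒nf≡ (≡-dec _≟_ (nf v) (nf w))

∷-insert-sorted : ∀ {y x w} → y ≤ x → Sorted (y ∷ w) → Sorted (y ∷ insert x w)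
∷-insert-sorted {w = []}    y≤x _ = y≤x ∷ [-]
∷-insert-sorted {y} {x} {z ∷ w} y≤x (y≤z ∷ z∷w↗) with z <? x
... | yes z<x = y≤z ∷ ∷-insert-sorted (≤-trans (<⇒≤ z<x) (n≤1+n x)) z∷w↗
... | no  z≮x = y≤x ∷ ≮⇒≥ z≮x ∷ z∷w↗

insert-sorted : ∀ x w → Sorted w → Sorted (insert x w)
insert-sorted x []      _   = [-]
insert-sorted x (y ∷ w) w↗ with y <? x
... | yes y<x = ∷-insert-sorted (≤-trans (<⇒≤ y<x) (n≤1+n x)) w↗
... | no  y≮x = ≮⇒≥ y≮x ∷ w↗

nf-sorted : ∀ w → Sorted (nf w)
nf-sorted []      = []
nf-sorted (x ∷ w) = insert-sorted x (nf w) (nf-sorted w)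

∷-sorted : ∀ {y w} → All (y ≤_) w → Sorted w → Sorted (y ∷ w)
∷-sorted []        _  = [-]
∷-sorted (y≤z ∷ _) w↗ = y≤z ∷ w↗

sorted⇒nf≡ : ∀ {w} → Sorted w → nf w ≡ w
sorted⇒nf≡ []                = refl
sorted⇒nf≡ [-]               = refl
sorted⇒nf≡ {x ∷ w} (x≤y ∷ w↗) = trans (cong (insert x) (sorted⇒nf≡ w↗)) (insert-≥ x≤y)

-- Counting factorizations

≈₂-refl : ∀ {f} → f ≈₂ f
≈₂-refl {_ , _} = ~-refl , ~-refl

≈₂-sym : ∀ {f g} → f ≈₂ g → g ≈₂ f
≈₂-sym {_ , _} {_ , _} (p , q) = ~-sym p , ~-sym q

≈₂-trans : ∀ {f g h} → f ≈₂ g → g ≈₂ h → f ≈₂ h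
≈₂-trans {_ , _} {_ , _} {_ , _} (p , q) (p′ , q′) = ~-trans p p′ , ~-trans q q′

HasTau-resp-~ : ∀ {z z′ t} → z ~ z′ → HasTau z t → HasTau z′ t
HasTau-resp-~ z~z′ (fs , len , facts , distinct , complete) =
  fs , len , All.map (λ p → ~-trans p z~z′) facts , distinct ,
  λ f p → complete f (~-trans p (~-sym z~z′))

injection≤τ : ∀ {z t m} → HasTau z t → (F : Fin m → Word × Word) →
              (∀ k → IsFactorization z (F k)) → (∀ k l → F k ≈₂ F l → k ≡ l) → m ≤ t
injection≤τ {z} (fs , refl , _ , _ , complete) F facts distinct = injective⇒≤ index-injective
  where
  index : ∀ k → Any (F k ≈₂_) fs
  index k = complete (F k) (facts k)
  index-injective : ∀ {k l} → Any.index (index k) ≡ Any.index (index l) → k ≡ l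
  index-injective {k} {l} eq = distinct k l (≈₂-trans (Any.lookup-index (index k))
    (≈₂-sym (subst (λ i → F l ≈₂ Data.List.lookup fs i) (sym eq) (Any.lookup-index (index l)))))

split : (z : Word) → Fin (suc (length z)) → Word × Word
split z k = take (toℕ k) z , drop (toℕ k) z

split-factorization : ∀ z k → IsFactorization z (split z k)
split-factorization z k = ≡⇒~ (take++drop≡id (toℕ k) z)

split-injective : ∀ z {k l} → split z k ≈₂ split z l → k ≡ l
split-injective z {k} {l} (take~take , _) =
  toℕ-injective (trans (sym (length-prefix k)) (trans (~-length take~take) (length-prefix l)))
  where
  length-prefix : ∀ k → length (take (toℕ k) z) ≡ toℕ k
  length-prefix k = trans (length-take (toℕ k) z) (m≤n⇒m⊓n≡m (toℕ≤pred[n] k))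

length<τ : ∀ {z t} → HasTau z t → length z < t
length<τ {z} τz = injection≤τ τz (split z) (split-factorization z) (λ _ _ → split-injective z)

take-length-++ : ∀ (a b : Word) → take (length a) (a ++ b) ≡ a
take-length-++ []      b = refl
take-length-++ (x ∷ a) b = cong (x ∷_) (take-length-++ a b)

drop-length-++ : ∀ (a b : Word) → drop (length a) (a ++ b) ≡ b
drop-length-++ []      b = refl
drop-length-++ (x ∷ a) b = drop-length-++ a b

split-complete : ∀ a b → Any ((a , b) ≈₂_) (tabulate (split (a ++ b)))
split-complete a b = Any.tabulate⁺ {f = split (a ++ b)} k (≡⇒~ (sym prefix) , ≡⇒~ (sym suffix))
  where
  a-short : length a < suc (length (a ++ b))
  a-short = s≤s (subst (length a ≤_) (sym (length-++ a)) (m≤m+n (length a) (length b)))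
  k : Fin (suc (length (a ++ b)))
  k = fromℕ< a-short
  prefix : take (toℕ k) (a ++ b) ≡ a
  prefix = trans (cong (λ n → take n (a ++ b)) (toℕ-fromℕ< a-short)) (take-length-++ a b)
  suffix : drop (toℕ k) (a ++ b) ≡ b
  suffix = trans (cong (λ n → drop n (a ++ b)) (toℕ-fromℕ< a-short)) (drop-length-++ a b)

τ-rigid : ∀ {z} → (∀ {w} → w ~ z → w ≡ z) → HasTau z (suc (length z))
τ-rigid {z} rigid =
  tabulate (split z) , length-tabulate (split z) , All.tabulate⁺ {f = split z} (split-factorization z) ,
  AllPairs.tabulate⁺ {f = split z} (λ k≢l p → k≢l (split-injective z p)) , complete
  where
  complete : ∀ f → IsFactorization z f → Any (f ≈₂_) (tabulate (split z))
  complete (a , b) ab~z = subst (λ w → Any ((a , b) ≈₂_) (tabulate (split w))) (rigid ab~z) (split-complete a b)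

-- Powers of a generator

gen^ʷ≡replicate : ∀ i n → gen i ^ʷ n ≡ replicate n i
gen^ʷ≡replicate i zero    = refl
gen^ʷ≡replicate i (suc n) = cong (i ∷_) (gen^ʷ≡replicate i n)

^ʷ-+ : ∀ u m n → u ^ʷ (m + n) ≡ (u ^ʷ m) ++ (u ^ʷ n)
^ʷ-+ u zero    n = refl
^ʷ-+ u (suc m) n = trans (cong (u ++_) (^ʷ-+ u m n)) (sym (++-assoc u (u ^ʷ m) (u ^ʷ n)))

^ʷ-* : ∀ u m n → (u ^ʷ m) ^ʷ n ≡ u ^ʷ (n * m)
^ʷ-* u m zero    = refl
^ʷ-* u m (suc n) = trans (cong ((u ^ʷ m) ++_) (^ʷ-* u m n)) (sym (^ʷ-+ u m (n * m)))

-- Each side of a defining relation contains two distinct letters.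
~-resp-constant : ∀ {i v w} → v ~ w → (All (_≡ i) v → All (_≡ i) w) × (All (_≡ i) w → All (_≡ i) v)
~-resp-constant ~-refl        = (λ c → c) , (λ c → c)
~-resp-constant (~-sym p)     = proj₂ (~-resp-constant p) , proj₁ (~-resp-constant p)
~-resp-constant (~-trans p q) =
  (λ c → proj₁ (~-resp-constant q) (proj₁ (~-resp-constant p) c)) ,
  (λ c → proj₂ (~-resp-constant p) (proj₂ (~-resp-constant q) c))
~-resp-constant (~-rel xs ys {i} {j} i<j) = left , right
  where
  left : All _ (xs ++ j ∷ i ∷ ys) → _
  left c with All.++⁻ʳ xs c
  ... | refl ∷ refl ∷ _ = ⊥-elim (<-irrefl refl i<j)
  right : All _ (xs ++ i ∷ suc j ∷ ys) → _
  right c with All.++⁻ʳ xs c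
  ... | refl ∷ refl ∷ _ = ⊥-elim (<-irrefl refl (m<n⇒m<1+n i<j))

constant⇒≡replicate : ∀ {i : ℕ} {w : Word} → All (_≡ i) w → w ≡ replicate (length w) i
constant⇒≡replicate []         = refl
constant⇒≡replicate (refl ∷ c) = cong (_ ∷_) (constant⇒≡replicate c)

replicate-rigid : ∀ {n i w} → w ~ replicate n i → w ≡ replicate n i
replicate-rigid {n} {i} w~iⁿ = trans (constant⇒≡replicate constant)
  (cong (λ m → replicate m i) (trans (~-length w~iⁿ) (length-replicate n)))
  where
  constant : All (_≡ i) _
  constant = proj₂ (~-resp-constant w~iⁿ) (All.replicate⁺ n refl)

τ-replicate : ∀ n i → HasTau (replicate n i) (suc n)
τ-replicate n i = subst (λ m → HasTau (replicate n i) (suc m)) (length-replicate n) (τ-rigid replicate-rigid)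

generator-irreducible : ∀ i → Irreducible (gen i)
generator-irreducible = τ-replicate 1

factorization-of-[] : ∀ {a b} → IsFactorization [] (a , b) → (a , b) ≈₂ ([] , [])
factorization-of-[] {[]}    {[]}    _ = ~-refl , ~-refl
factorization-of-[] {[]}    {_ ∷ _} p with ~-length p
... | ()
factorization-of-[] {_ ∷ _}         p with ~-length p
... | ()

irreducible⇒generator : ∀ {q} → Irreducible q → ∃ λ i → q ≡ gen i
irreducible⇒generator {[]} (_ ∷ _ ∷ [] , _ , f ∷ g ∷ [] , (f≉g ∷ []) ∷ _ , _) =
  ⊥-elim (f≉g (≈₂-trans (factorization-of-[] f) (≈₂-sym (factorization-of-[] g))))
irreducible⇒generator {x ∷ []}    _  = x , refl
irreducible⇒generator {_ ∷ _ ∷ _} τq with length<τ τq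
... | s≤s (s≤s ())

sorted-~⇒≡ : ∀ {v w} → Sorted v → Sorted w → v ~ w → v ≡ w
sorted-~⇒≡ v↗ w↗ v~w = trans (sym (sorted⇒nf≡ v↗)) (trans (~⇒nf≡ v~w) (sorted⇒nf≡ w↗))

-- Words that are not powers of a generator

-- Below c w: the letter c can travel rightwards through w, becoming c + i after i steps.
Below : ℕ → Word → Set
Below c []      = ⊤
Below c (y ∷ w) = y < c × Below (suc c) w

≤⇒Below : ∀ {b c w} → All (_≤ b) w → b < c → Below c w
≤⇒Below []           _   = tt
≤⇒Below (y≤b ∷ w≤b) b<c = ≤-<-trans y≤b b<c , ≤⇒Below w≤b (m<n⇒m<1+n b<c)

pass-below : ∀ c w → Below c w → (c ∷ w) ~ (w ∷ʳ (c + length w))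
pass-below c []      _             = ≡⇒~ (cong (_∷ []) (sym (+-identityʳ c)))
pass-below c (y ∷ w) (y<c , below) =
  ~-trans (~-rel [] w y<c)
    (~-trans (~-++ˡ (y ∷ []) (pass-below (suc c) w below))
      (≡⇒~ (cong (λ d → y ∷ w ∷ʳ d) (sym (+-suc c (length w))))))

pass-above : ∀ c A R → All (2 + c ≤_) A → (c ∷ A ++ R) ~ (map pred A ++ c ∷ R)
pass-above c []          R _                   = ~-refl
pass-above c (zero ∷ A)  R (() ∷ _)
pass-above c (suc j ∷ A) R (s≤s c<j ∷ A-above) =
  ~-trans (~-sym (~-rel [] (A ++ R) c<j)) (~-++ˡ (j ∷ []) (pass-above c A R A-above))

bits : ∀ n → Fin (2 ^ n) → Vec (Fin 2) n
bits zero    _ = []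
bits (suc n) i = quotient (2 ^ n) i ∷ bits n (remainder {2} (2 ^ n) i)

bits-injective : ∀ n {i j} → bits n i ≡ bits n j → i ≡ j
bits-injective zero    {Fin.zero} {Fin.zero} _ = refl
bits-injective (suc n) {i} {j} eq = begin
  i                                   ≡⟨ combine-remQuot {2} (2 ^ n) i ⟨
  uncurry combine (remQuot (2 ^ n) i) ≡⟨ cong₂ combine (cong Vec.head eq) (bits-injective n (cong Vec.tail eq)) ⟩
  uncurry combine (remQuot (2 ^ n) j) ≡⟨ combine-remQuot {2} (2 ^ n) j ⟩
  j                                   ∎
  where open ≡-Reasoning

module Exponential (a b : ℕ) (v : Word) (a<b : a < b) (v≤b : All (_≤ b) v) where

  x : Word
  x = a ∷ v

  ℓ : ℕ
  ℓ = length x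

  W : Word
  W = x ∷ʳ b

  progression : ℕ → ℕ → Word
  progression c zero    = []
  progression c (suc n) = c ∷ progression (c + suc ℓ) n

  length-progression : ∀ c n → length (progression c n) ≡ n
  length-progression c zero    = refl
  length-progression c (suc n) = cong suc (length-progression (c + suc ℓ) n)

  progression-below : ∀ n {c d} → c + n * ℓ ≤ d → Below d (progression c n)
  progression-below zero    _ = tt
  progression-below (suc n) {c} {d} le =
    <-≤-trans (m<m+n c z<s) le ,
    progression-below n (≤-trans (≤-reflexive (shift c ℓ n)) (s≤s le))
    where
    shift : ∀ c ℓ n → c + suc ℓ + n * ℓ ≡ suc (c + (ℓ + n * ℓ))
    shift = solve-∀

  progression-∷ʳ : ∀ n c → progression c n ∷ʳ (c + n * suc ℓ) ≡ progression c (suc n)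
  progression-∷ʳ zero    c = cong (_∷ []) (+-identityʳ c)
  progression-∷ʳ (suc n) c =
    cong (c ∷_) (trans (cong (progression (c + suc ℓ) n ∷ʳ_) (sym (+-assoc c (suc ℓ) (n * suc ℓ))))
                       (progression-∷ʳ n (c + suc ℓ)))

  xⁿ≤b : ∀ n → All (_≤ b) (x ^ʷ n)
  xⁿ≤b zero    = []
  xⁿ≤b (suc n) = All.++⁺ (<⇒≤ a<b ∷ v≤b) (xⁿ≤b n)

  xⁿ-below : ∀ n {c} → b ≤ c → Below c (x ^ʷ n)
  xⁿ-below zero    _   = tt
  xⁿ-below (suc n) b≤c = <-≤-trans a<b b≤c , ≤⇒Below (All.++⁺ v≤b (xⁿ≤b n)) (s≤s b≤c)

  length-xⁿ : ∀ n → length (x ^ʷ n) ≡ n * ℓ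
  length-xⁿ zero    = refl
  length-xⁿ (suc n) = trans (length-++ x) (cong (ℓ +_) (length-xⁿ n))

  Wⁿ~xⁿ++progression : ∀ n → (W ^ʷ n) ~ ((x ^ʷ n) ++ progression b n)
  Wⁿ~xⁿ++progression zero    = ~-refl
  Wⁿ~xⁿ++progression (suc n) = begin
    (x ∷ʳ b) ++ W ^ʷ n                          ≡⟨ ++-assoc x (b ∷ []) (W ^ʷ n) ⟩
    x ++ b ∷ W ^ʷ n                             ≈⟨ ~-++ˡ x (~-++ˡ (b ∷ []) (Wⁿ~xⁿ++progression n)) ⟩
    x ++ b ∷ xⁿ ++ P                            ≈⟨ ~-++ˡ x (~-++ʳ P (pass-below b xⁿ (xⁿ-below n ≤-refl))) ⟩
    x ++ (xⁿ ∷ʳ (b + length xⁿ)) ++ P           ≡⟨ cong (x ++_) (++-assoc xⁿ _ P) ⟩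
    x ++ xⁿ ++ (b + length xⁿ) ∷ P              ≈⟨ ~-++ˡ x (~-++ˡ xⁿ (pass-below _ P (progression-below n b+nℓ≤))) ⟩
    x ++ xⁿ ++ P ∷ʳ (b + length xⁿ + length P)  ≡⟨ cong (λ d → x ++ xⁿ ++ P ∷ʳ d) last ⟩
    x ++ xⁿ ++ P ∷ʳ (b + n * suc ℓ)             ≡⟨ cong (λ w → x ++ xⁿ ++ w) (progression-∷ʳ n b) ⟩
    x ++ xⁿ ++ progression b (suc n)            ≡⟨ ++-assoc x xⁿ _ ⟨
    (x ^ʷ suc n) ++ progression b (suc n)       ∎
    where
    open SetoidReasoning ~-setoid
    xⁿ : Word
    xⁿ = x ^ʷ n
    P : Word
    P = progression b n
    b+nℓ≤ : b + n * ℓ ≤ b + length xⁿ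
    b+nℓ≤ = ≤-reflexive (cong (b +_) (sym (length-xⁿ n)))
    last : b + length xⁿ + length P ≡ b + n * suc ℓ
    last = trans (cong₂ (λ p q → b + p + q) (length-xⁿ n) (length-progression b n)) (collect b n ℓ)
      where
      collect : ∀ b n ℓ → b + n * ℓ + n ≡ b + n * suc ℓ
      collect = solve-∀

  select : ∀ {n} → ℕ → Vec (Fin 2) n → Word
  select c []        = []
  select c (0F ∷ s)  = select (c + suc ℓ) s
  select c (1F ∷ s)  = c ∷ select (c + suc ℓ) s

  select-≥ : ∀ {n} c (s : Vec (Fin 2) n) → All (c ≤_) (select c s)
  select-≥ c []       = []
  select-≥ c (0F ∷ s) = All.map (≤-trans (m≤m+n c (suc ℓ))) (select-≥ (c + suc ℓ) s)
  select-≥ c (1F ∷ s) = ≤-refl ∷ All.map (≤-trans (m≤m+n c (suc ℓ))) (select-≥ (c + suc ℓ) s)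

  select-sorted : ∀ {n} c (s : Vec (Fin 2) n) → Sorted (select c s)
  select-sorted c []       = []
  select-sorted c (0F ∷ s) = select-sorted (c + suc ℓ) s
  select-sorted c (1F ∷ s) =
    ∷-sorted (All.map (≤-trans (m≤m+n c (suc ℓ))) (select-≥ (c + suc ℓ) s)) (select-sorted (c + suc ℓ) s)

  select-injective : ∀ {n} c (s s′ : Vec (Fin 2) n) → select c s ≡ select c s′ → s ≡ s′
  select-injective c []       []        _  = refl
  select-injective c (0F ∷ s) (0F ∷ s′) eq = cong (0F ∷_) (select-injective (c + suc ℓ) s s′ eq)
  select-injective c (1F ∷ s) (1F ∷ s′) eq = cong (1F ∷_) (select-injective (c + suc ℓ) s s′ (∷-injectiveʳ eq))
  select-injective c (0F ∷ s) (1F ∷ s′) eq =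
    ⊥-elim (m+1+n≰m c (All.head (subst (All (c + suc ℓ ≤_)) eq (select-≥ (c + suc ℓ) s))))
  select-injective c (1F ∷ s) (0F ∷ s′) eq =
    ⊥-elim (m+1+n≰m c (All.head (subst (All (c + suc ℓ ≤_)) (sym eq) (select-≥ (c + suc ℓ) s′))))

  progression-split : ∀ {n} c (s : Vec (Fin 2) n) →
                      ∃ λ A → All (c ≤_) A × (progression c n ~ (A ++ select c s))
  progression-split c [] = [] , [] , ~-refl
  progression-split c (0F ∷ s) with progression-split (c + suc ℓ) s
  ... | A , A≥ , P~ = c ∷ A , ≤-refl ∷ All.map (≤-trans (m≤m+n c (suc ℓ))) A≥ , ~-++ˡ (c ∷ []) P~
  progression-split c (1F ∷ s) with progression-split (c + suc ℓ) s
  ... | A , A≥ , P~ =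
    map pred A , All.map⁺ (All.map (λ le → pred-mono-≤ (≤-trans (m<m+n c z<s) le)) A≥) ,
    ~-trans (~-++ˡ (c ∷ []) P~) (pass-above c A _ (All.map (≤-trans 2+c≤c+k) A≥))
    where
    2+c≤c+k : 2 + c ≤ c + suc ℓ
    2+c≤c+k = ≤-trans (s≤s (s≤s (m≤m+n c (length v))))
                      (≤-reflexive (sym (trans (+-suc c ℓ) (cong suc (+-suc c (length v))))))

  τ-exponential : ∀ n t → HasTau (W ^ʷ n) t → 2 ^ n ≤ t
  τ-exponential n t τWⁿ = injection≤τ τWⁿ F factorization distinct
    where
    prefix : Vec (Fin 2) n → Word
    prefix s = proj₁ (progression-split b s)
    F : Fin (2 ^ n) → Word × Word
    F i = (x ^ʷ n) ++ prefix (bits n i) , select b (bits n i)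
    factorization : ∀ i → IsFactorization (W ^ʷ n) (F i)
    factorization i = ~-trans (≡⇒~ (++-assoc (x ^ʷ n) (prefix s) (select b s)))
      (~-trans (~-++ˡ (x ^ʷ n) (~-sym (proj₂ (proj₂ (progression-split b s))))) (~-sym (Wⁿ~xⁿ++progression n)))
      where s = bits n i
    distinct : ∀ i j → F i ≈₂ F j → i ≡ j
    distinct i j (_ , select~select) = bits-injective n (select-injective b _ _
      (sorted-~⇒≡ (select-sorted b (bits n i)) (select-sorted b (bits n j)) select~select))

replicate-∷ʳ : ∀ n (y : ℕ) → y ∷ replicate n y ≡ replicate n y ∷ʳ y
replicate-∷ʳ zero    y = refl
replicate-∷ʳ (suc n) y = cong (y ∷_) (replicate-∷ʳ n y)

sorted⇒constant⊎ascent : ∀ {a w} → Sorted (a ∷ w) →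
  All (_≡ a) w ⊎ ∃ λ v → ∃ λ b → w ≡ v ∷ʳ b × a < b × All (_≤ b) v
sorted⇒constant⊎ascent {w = []} _ = inj₁ []
sorted⇒constant⊎ascent {a} {y ∷ w} (a≤y ∷ y∷w↗) with sorted⇒constant⊎ascent y∷w↗ | a ≟ y
... | inj₁ w≡y | yes refl = inj₁ (refl ∷ w≡y)
... | inj₁ w≡y | no  a≢y  = inj₂ (replicate (length w) y , y ,
  trans (cong (y ∷_) (constant⇒≡replicate w≡y)) (replicate-∷ʳ (length w) y) ,
  ≤∧≢⇒< a≤y a≢y , All.replicate⁺ (length w) ≤-refl)
... | inj₂ (v , b , refl , y<b , v≤b) | _ = inj₂ (y ∷ v , b , refl , ≤-<-trans a≤y y<b , <⇒≤ y<b ∷ v≤b)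

irreducible-power⊎exponential : ∀ u → IsIrreduciblePower u ⊎ ExponentialTau u
irreducible-power⊎exponential u with nf u | nf-~ u | nf-sorted u
... | []    | []~u | _  = inj₁ (gen 0 , 0 , generator-irreducible 0 , ~-sym []~u)
... | a ∷ w | nf~u | nf↗ with sorted⇒constant⊎ascent nf↗
...   | inj₁ w≡a = inj₁ (gen a , suc (length w) , generator-irreducible a , ~-trans (~-sym nf~u) (≡⇒~ nf≡aⁿ))
  where
  nf≡aⁿ : a ∷ w ≡ gen a ^ʷ suc (length w)
  nf≡aⁿ = trans (cong (a ∷_) (constant⇒≡replicate w≡a)) (sym (gen^ʷ≡replicate a (suc (length w))))
...   | inj₂ (v , b , refl , a<b , v≤b) = inj₂ λ n t τuⁿ →
  Exponential.τ-exponential a b v a<b v≤b n t (HasTau-resp-~ (^ʷ-cong n (~-sym nf~u)) τuⁿ)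

irreducible-power⇒τ-linear : ∀ {u} → IsIrreduciblePower u → ∃ λ m → ∀ n → HasTau (u ^ʷ n) (suc (n * m))
irreducible-power⇒τ-linear {u} (q , m , τq , u~qᵐ) with irreducible⇒generator τq
... | i , refl = m , λ n → HasTau-resp-~ (~-sym (uⁿ~ n)) (τ-replicate (n * m) i)
  where
  uⁿ~ : ∀ n → (u ^ʷ n) ~ replicate (n * m) i
  uⁿ~ n = ~-trans (^ʷ-cong n u~qᵐ) (≡⇒~ (trans (^ʷ-* (gen i) m n) (gen^ʷ≡replicate i (n * m))))

irreducible-power⇒τ₀≡1 : ∀ {u} → IsIrreduciblePower u → Tau0Is u 1ℚ
irreducible-power⇒τ₀≡1 power = let (m , τ-linear) = irreducible-power⇒τ-linear power in linear⇒τ₀≡1 m τ-linear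

-- Finiteness of τ

_≈₂?_ : Decidable _≈₂_
(a , b) ≈₂? (c , d) = (a ~? c) ×-dec (b ~? d)

≈₂-decSetoid : DecSetoid _ _
≈₂-decSetoid = record
  { Carrier          = Word × Word
  ; _≈_              = _≈₂_
  ; isDecEquivalence = record
    { isEquivalence = record { refl = ≈₂-refl ; sym = ≈₂-sym ; trans = ≈₂-trans }
    ; _≟_           = _≈₂?_
    }
  }

factorization? : ∀ z → U.Decidable (IsFactorization z)
factorization? z (a , b) = (a ++ b) ~? z

insert-⊇ : ∀ x w → w ⊆ insert x w
insert-⊇ x (y ∷ w) y∈ with y <? x | y∈
... | yes _ | here refl = here refl
... | yes _ | there y∈w = there (insert-⊇ (suc x) w y∈w)
... | no  _ | _         = there y∈

insert-above : ∀ x w → Any (x ≤_) (insert x w)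
insert-above x []      = here ≤-refl
insert-above x (y ∷ w) with y <? x
... | yes _ = there (Any.map (≤-trans (n≤1+n x)) (insert-above (suc x) w))
... | no  _ = here ≤-refl

nf-dominates : ∀ w → All (λ y → Any (y ≤_) (nf w)) w
nf-dominates []      = []
nf-dominates (x ∷ w) = insert-above x (nf w) ∷ All.map (Any-resp-⊆ (insert-⊇ x (nf w))) (nf-dominates w)

wordsOfLength : ℕ → ℕ → List Word
wordsOfLength M zero    = [] ∷ []
wordsOfLength M (suc n) = concatMap (λ y → map (y ∷_) (wordsOfLength M n)) (upTo M)

shortWords : ℕ → ℕ → List Word
shortWords M L = concatMap (wordsOfLength M) (upTo (suc L))

∈-wordsOfLength : ∀ {M w} → All (_< M) w → w ∈ wordsOfLength M (length w)
∈-wordsOfLength []            = here refl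
∈-wordsOfLength {M} {y ∷ w} (y<M ∷ w<M) =
  ∈-concatMap⁺ (λ y → map (y ∷_) (wordsOfLength M (length w)))
    (Any.map (λ { refl → ∈-map⁺ (y ∷_) (∈-wordsOfLength w<M) }) (∈-upTo⁺ y<M))

∈-shortWords : ∀ {M L w} → All (_< M) w → length w ≤ L → w ∈ shortWords M L
∈-shortWords {M} w<M |w|≤L =
  ∈-concatMap⁺ (wordsOfLength M) (Any.map (λ { refl → ∈-wordsOfLength w<M }) (∈-upTo⁺ (s≤s |w|≤L)))

-- Up to _≈₂_ each factorization of z is a pair of normal forms, and these are short words
-- whose letters are bounded by the largest letter of nf z.
τ-exists : ∀ z → ∃ (HasTau z)
τ-exists z = length fs , fs , refl , facts , deduplicate-! ≈₂-decSetoid factorizations , complete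
  where
  words : List Word
  words = shortWords (suc (max 0 (nf z))) (length z)
  candidates : List (Word × Word)
  candidates = cartesianProduct words words
  factorizations : List (Word × Word)
  factorizations = filter (factorization? z) candidates
  fs : List (Word × Word)
  fs = deduplicate _≈₂?_ factorizations
  facts : All (IsFactorization z) fs
  facts = All.deduplicate⁺ _≈₂?_ (All.all-filter (factorization? z) candidates)
  complete : ∀ f → IsFactorization z f → Any (f ≈₂_) fs
  complete (a , b) ab~z = Any.deduplicate⁺ _≈₂?_ (λ g≈h f≈g → ≈₂-trans f≈g (≈₂-sym g≈h))
    (Any.map (λ { refl → ~-sym (nf-~ a) , ~-sym (nf-~ b) }) nf∈)
    where
    nfab~z : (nf a ++ nf b) ~ z
    nfab~z = ~-trans (~-++ (nf-~ a) (nf-~ b)) ab~z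
    bounded : All (_< suc (max 0 (nf z))) (nf a ++ nf b)
    bounded = All.map (λ y≤ → s≤s (v≤max⁺ 0 (nf z) (inj₂ (subst (Any _) (~⇒nf≡ nfab~z) y≤))))
                      (nf-dominates (nf a ++ nf b))
    short : length (nf a) + length (nf b) ≤ length z
    short = ≤-reflexive (trans (sym (length-++ (nf a))) (~-length nfab~z))
    nf∈ : (nf a , nf b) ∈ factorizations
    nf∈ = ∈-filter⁺ (factorization? z)
      (∈-cartesianProduct⁺ (∈-shortWords (All.++⁻ˡ (nf a) bounded) (≤-trans (m≤m+n _ _) short))
                           (∈-shortWords (All.++⁻ʳ (nf a) bounded) (≤-trans (m≤n+m _ _) short)))
      nfab~z

mainTheorem19 : (u : Word) →
    ((Tau0Is u 1ℚ → IsIrreduciblePower u) × (IsIrreduciblePower u → Tau0Is u 1ℚ)) ×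
    (¬ IsIrreduciblePower u → Tau0AtLeast u (ℕ→ℚ 2))
mainTheorem19 u with irreducible-power⊎exponential u
... | inj₁ power       = (const power , const (irreducible-power⇒τ₀≡1 power)) , λ ¬power → ⊥-elim (¬power power)
... | inj₂ exponential =
  (⊥-elim ∘ exponential⇒τ₀≢1 exponential , ⊥-elim ∘ exponential⇒τ₀≢1 exponential ∘ irreducible-power⇒τ₀≡1) ,
  const (exponential⇒τ₀≥2 (λ n → τ-exists (u ^ʷ n)) exponential)
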